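{- There exists a function $f:\mathbb N\to\mathbb N$ such that for every graph $G$, every independent set $I$ of $G$, and every $k$-flip $F=(\iota,\tau)$ on $V(G)$, there exist a partition $J_1,\dots,J_p$ of $I$ into at most $2k$ parts and an $f(k)$-flip $F'$ on $V(G)$ such that $G\ast I\oplus F'=G\oplus F\ast J_1\ast\dots\ast J_p$ (in particular, each $J_i$ is independent in the graph $G\oplus F\ast J_1\ast\dots\ast J_{i-1}$ to which it is applied).
   Context: Graphs are finite and simple; adjacency $E_G(u,v)\in\mathrm{GF}(2)$. A $k$-flip on $V$ is $F=(\iota,\tau)$ with $\iota:V\to[k]$ and $\tau:[k]\times[k]\to\mathrm{GF}(2)$ symmetric; $G\oplus F$ has $E_{G\oplus F}(x,y)=E_G(x,y)+\tau(\iota(x),\iota(y))$ for distinct $x,y$. For a vertex $v$, $E_{G\ast v}(x,y)=E_G(x,y)+E_G(x,v)E_G(v,y)$; for a set $J$ independent in the current graph, $\ast J$ denotes successive local complementation of all vertices of $J$ (order irrelevant); the notation $H\ast J$ is only used when $J$ is independent in $H$. Expressions are evaluated left to right. -}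

module Defs where

open import Data.Nat using (ℕ; zero; suc)
open import Data.Fin using (Fin; zero; suc; _≟_)
open import Data.Bool using (Bool; true; false; if_then_else_; _xor_; _∧_)
open import Data.List using (List; foldl; allFin)
open import Data.Product using (Σ; ∃; ∃-syntax; _×_)
open import Data.Unit using (⊤)
open import Relation.Binary.PropositionalEquality using (_≡_)
open import Relation.Nullary.Decidable using (⌊_⌋)
open import Function using (_∘_)

-- Adjacency "matrix" of a graph on vertex set Fin n, with values in GF(2) = Bool
-- (addition = xor, multiplication = ∧).
Adj : ℕ → Set
Adj n = Fin n → Fin n → Bool

record IsGraph {n : ℕ} (G : Adj n) : Set where
  field
    sym   : ∀ x y → G x y ≡ G y x
    loopless : ∀ x → G x x ≡ false

VSet : ℕ → Set
VSet n = Fin n → Bool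

Independent : {n : ℕ} → Adj n → VSet n → Set
Independent G I = ∀ x y → I x ≡ true → I y ≡ true → G x y ≡ false

_∗v_ : {n : ℕ} → Adj n → Fin n → Adj n
(G ∗v v) x y = if ⌊ x ≟ y ⌋ then false else (G x y xor (G x v ∧ G v y))

_∗_ : {n : ℕ} → Adj n → VSet n → Adj n
_∗_ {n} G J = foldl (λ H v → if J v then H ∗v v else H) G (allFin n)

record Flip (n k : ℕ) : Set where
  field
    ι : Fin n → Fin k
    τ : Fin k → Fin k → Bool
    τ-sym : ∀ a b → τ a b ≡ τ b a

_⊕_ : {n k : ℕ} → Adj n → Flip n k → Adj n
(G ⊕ F) x y = if ⌊ x ≟ y ⌋ then false else (G x y xor Flip.τ F (Flip.ι F x) (Flip.ι F y))

_≈_ : {n : ℕ} → Adj n → Adj n → Set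
G ≈ H = ∀ x y → G x y ≡ H x y

applyParts : {n : ℕ} (p : ℕ) → (Fin p → VSet n) → Adj n → Adj n
applyParts zero    J H = H
applyParts (suc p) J H = applyParts p (J ∘ suc) (H ∗ J zero)

AllIndependent : {n : ℕ} (p : ℕ) → (Fin p → VSet n) → Adj n → Set
AllIndependent zero    J H = ⊤
AllIndependent (suc p) J H = Independent H (J zero) × AllIndependent p (J ∘ suc) (H ∗ J zero)

record IsPartition {n p : ℕ} (I : VSet n) (J : Fin p → VSet n) : Set where
  field
    nonempty : ∀ i → ∃[ v ] J i v ≡ true
    subset   : ∀ i v → J i v ≡ true → I v ≡ true
    cover    : ∀ v → I v ≡ true → ∃[ i ] J i v ≡ true
    disjoint : ∀ i j v → J i v ≡ true → J j v ≡ true → i ≡ j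

module Submission where

-- Every part lies in I, which is independent in G. Complementing at a set J that is independent in
-- the current graph K changes K x y (x ≠ y) by Σ_{v ∈ J} K x v · K v y, so by induction every
-- intermediate graph is G ∗ P followed by a flip, where P is the union of the parts processed so far
-- and the flip only depends on a label of each vertex: its F-class and, for every part, whether the
-- vertex lies in it and the parity of its G-neighbours in it. There are k · 16^k labels, and for
-- P = I this flip is F′.
--
-- Since G has no edges inside I, every class I ∩ ι⁻¹(c) is a clique or an independent set of G ⊕ F;
-- split off one vertex, and the rest of the class becomes independent after complementing at it.

open import Defs
open import Algebra using (CommutativeRing)
open import Data.Bool using (Bool; true; false; if_then_else_; _xor_; _∧_; not)
open import Data.Bool.Properties
  using ( xor-∧-commutativeRing; ∧-distribʳ-xor; xor-assoc; xor-identityʳ; xor-same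
        ; ∧-zeroʳ; ∧-identityʳ; ∧-idem)
  renaming (_≟_ to _≟ᵇ_)
open import Data.Empty using (⊥)
open import Data.Fin using (Fin; zero; suc; _≟_; combine; quotient; remainder; funToFin; finToFun)
open import Data.Fin.Properties using (any?; suc-injective; remQuot-combine; finToFun-funToFin; 2↔Bool)
open import Data.List using (List; []; _∷_; foldl; tabulate; allFin; length; lookup; filter)
open import Data.List.Membership.Propositional.Properties using (∈-lookup)
open import Data.List.Properties using (length-filter)
open import Data.List.Relation.Unary.All as All using (All; []; _∷_)
import Data.List.Relation.Unary.All.Properties as All
open import Data.List.Relation.Unary.AllPairs using (AllPairs; []; _∷_)
import Data.List.Relation.Unary.AllPairs.Properties as AllPairs
open import Data.List.Relation.Unary.Any as Any using (Any; here; there)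
open import Data.List.Relation.Unary.Any.Properties as Any using (lookup-index; lookup-result)
open import Data.Maybe using (Maybe; just; nothing)
open import Data.Nat using (ℕ; zero; suc; _+_; _*_; _^_; _≤_)
open import Data.Nat.Properties using (*-suc; ≤-trans; ≤-reflexive)
open import Data.Product using (Σ; ∃-syntax; _×_; _,_; proj₁; proj₂)
open import Data.Sum using (_⊎_; inj₁; inj₂)
open import Data.Unit using (tt)
open import Function using (_∘_; id; Inverse)
open import Function.Definitions using (Injective)
open import Relation.Binary.PropositionalEquality
open import Relation.Nullary using (yes; no; ¬_; contradiction; Dec)
open import Relation.Nullary.Decidable using (does; dec-true)
open import Relation.Unary using (Decidable)
open import Tactic.RingSolver using (solve-∀)
open import Tactic.RingSolver.Core.AlmostCommutativeRing using (AlmostCommutativeRing; fromCommutativeRing)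

open import Algebra.Properties.Semiring.Sum (CommutativeRing.semiring xor-∧-commutativeRing)
  using (sum-syntax; sum-cong-≗; sum-replicate-zero; ∑-distrib-+; *-distribˡ-sum)

private
  variable
    n : ℕ

  module 2↔Bool = Inverse 2↔Bool

GF2 : AlmostCommutativeRing _ _
GF2 = fromCommutativeRing xor-∧-commutativeRing isZero
  where
  isZero : (b : Bool) → Maybe (false ≡ b)
  isZero false = just refl
  isZero true  = nothing

∑-zero : (g : Fin n → Bool) → (∀ v → g v ≡ false) → ∑[ v < n ] g v ≡ false
∑-zero {n} g g≡0 = trans (sum-cong-≗ g≡0) (sum-replicate-zero n)

∑-select : (a : Fin n) (g : Fin n → Bool) → ∑[ v < n ] (does (a ≟ v) ∧ g v) ≡ g a
∑-select {suc n} zero g = trans (cong (g zero xor_) (∑-zero {n} _ λ _ → refl)) (xor-identityʳ (g zero))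
∑-select (suc a) g = ∑-select a (g ∘ suc)

∑-xor₄ : (a b c d : Fin n → Bool) →
         ∑[ v < n ] ((a v xor b v) xor (c v xor d v)) ≡
         (∑[ v < n ] a v xor ∑[ v < n ] b v) xor (∑[ v < n ] c v xor ∑[ v < n ] d v)
∑-xor₄ {n} a b c d = trans (∑-distrib-+ {n} _ _) (cong₂ _xor_ (∑-distrib-+ {n} a b) (∑-distrib-+ {n} c d))

∑-scale : (c : Bool) (g : Fin n → Bool) → ∑[ v < n ] (c ∧ g v) ≡ c ∧ ∑[ v < n ] g v
∑-scale c g = sym (*-distribˡ-sum c g)

∑-cong-on : (J g h : Fin n → Bool) → (∀ v → J v ≡ true → g v ≡ h v) →
            ∑[ v < n ] (J v ∧ g v) ≡ ∑[ v < n ] (J v ∧ h v)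
∑-cong-on J g h g≡h = sum-cong-≗ pointwise
  where
  pointwise : ∀ v → J v ∧ g v ≡ J v ∧ h v
  pointwise v with J v in Jv
  ... | true  = g≡h v Jv
  ... | false = refl

∧-guarded-zero : ∀ j {t} → (j ≡ true → t ≡ false) → j ∧ t ≡ false
∧-guarded-zero true  t≡0 = t≡0 refl
∧-guarded-zero false _   = refl

-- Local complementation at an independent set

Loopless : Adj n → Set
Loopless K = ∀ x → K x x ≡ false

pathsThrough : Adj n → VSet n → Fin n → Fin n → Bool
pathsThrough {n} K J x y = ∑[ v < n ] (J v ∧ (K x v ∧ K v y))

parity : Adj n → VSet n → Fin n → Bool
parity {n} K J x = ∑[ v < n ] (J v ∧ K x v)

∗v-diagonal : (K : Adj n) (v x : Fin n) → (K ∗v v) x x ≡ false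
∗v-diagonal K v x with x ≟ x
... | yes _   = refl
... | no  x≢x = contradiction refl x≢x

∗v-off-diagonal : (K : Adj n) (v : Fin n) {x y : Fin n} → x ≢ y →
                  (K ∗v v) x y ≡ K x y xor (K x v ∧ K v y)
∗v-off-diagonal K v {x} {y} x≢y with x ≟ y
... | yes x≡y = contradiction x≡y x≢y
... | no  _   = refl

pathsThrough-vanishˡ : ∀ {n} (K : Adj n) (J : VSet n) {x} y → (∀ v → J v ≡ true → K x v ≡ false) →
                       pathsThrough K J x y ≡ false
pathsThrough-vanishˡ K J {x} y Kx≡0 = ∑-zero _ λ v → ∧-guarded-zero (J v) λ Jv →
  cong (_∧ K v y) (Kx≡0 v Jv)

pathsThrough-vanishʳ : ∀ {n} (K : Adj n) (J : VSet n) x {y} → (∀ v → J v ≡ true → K v y ≡ false) →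
                       pathsThrough K J x y ≡ false
pathsThrough-vanishʳ K J x {y} K≡0y = ∑-zero _ λ v → ∧-guarded-zero (J v) λ Jv →
  trans (cong (K x v ∧_) (K≡0y v Jv)) (∧-zeroʳ (K x v))

pathsThrough-xor : ∀ {n} (K : Adj n) (P J : VSet n) x y →
  pathsThrough K (λ v → P v xor J v) x y ≡ pathsThrough K P x y xor pathsThrough K J x y
pathsThrough-xor {n} K P J x y =
  trans (sum-cong-≗ λ v → ∧-distribʳ-xor (K x v ∧ K v y) (P v) (J v)) (∑-distrib-+ {n} _ _)

⊕-diagonal : ∀ {n k} (K : Adj n) (F : Flip n k) x → (K ⊕ F) x x ≡ false
⊕-diagonal K F x with x ≟ x
... | yes _   = refl
... | no  x≢x = contradiction refl x≢x

⊕-off-diagonal : ∀ {n k} (K : Adj n) (F : Flip n k) {x y} → x ≢ y →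
                 (K ⊕ F) x y ≡ K x y xor Flip.τ F (Flip.ι F x) (Flip.ι F y)
⊕-off-diagonal K F {x} {y} x≢y with x ≟ y
... | yes x≡y = contradiction x≡y x≢y
... | no  _   = refl

foldl-preserves : {A B : Set} (P : B → Set) {f : B → A → B} →
                  (∀ {b} a → P b → P (f b a)) → ∀ {b} as → P b → P (foldl f b as)
foldl-preserves P step []       Pb = Pb
foldl-preserves P step (a ∷ as) Pb = foldl-preserves P step as (step a Pb)

foldl-preserves₂ : {A B : Set} (R : B → B → Set) {f : B → A → B} →
                   (∀ {b b′} a → R b b′ → R (f b a) (f b′ a)) →
                   ∀ {b b′} as → R b b′ → R (foldl f b as) (foldl f b′ as)
foldl-preserves₂ R step []       Rbb′ = Rbb′
foldl-preserves₂ R step (a ∷ as) Rbb′ = foldl-preserves₂ R step as (step a Rbb′)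

module LocalComplementation (J : VSet n) where

  complementIfIn : Adj n → Fin n → Adj n
  complementIfIn H v = if J v then H ∗v v else H

  complementIfIn-off-diagonal : (K : Adj n) (v : Fin n) {x y : Fin n} → x ≢ y →
                                complementIfIn K v x y ≡ K x y xor (J v ∧ (K x v ∧ K v y))
  complementIfIn-off-diagonal K v {x} {y} x≢y with J v
  ... | true  = ∗v-off-diagonal K v x≢y
  ... | false = sym (xor-identityʳ (K x y))

  complementIfIn-fixes : ∀ {K} → Independent K J → ∀ v x w → J w ≡ true →
                   complementIfIn K v x w ≡ K x w × complementIfIn K v w x ≡ K w x
  complementIfIn-fixes {K} ind v x w Jw with x ≟ w
  ... | yes refl = fixes-diagonal , fixes-diagonal
    where
    fixes-diagonal : complementIfIn K v x x ≡ K x x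
    fixes-diagonal with J v
    ... | true  = trans (∗v-diagonal K v x) (sym (ind x x Jw Jw))
    ... | false = refl
  ... | no  x≢w  =
    trans (complementIfIn-off-diagonal K v x≢w)
          (unchanged (K x w) λ Jv → trans (cong (K x v ∧_) (ind v w Jv Jw)) (∧-zeroʳ (K x v))) ,
    trans (complementIfIn-off-diagonal K v (x≢w ∘ sym))
          (unchanged (K w x) λ Jv → cong (_∧ K v x) (ind w v Jw Jv))
    where
    unchanged : ∀ a {t} → (J v ≡ true → t ≡ false) → a xor (J v ∧ t) ≡ a
    unchanged a t≡0 = trans (cong (a xor_) (∧-guarded-zero (J v) t≡0)) (xor-identityʳ a)

  complementIfIn-independent : ∀ {K} → Independent K J → ∀ v → Independent (complementIfIn K v) J
  complementIfIn-independent ind v x y Jx Jy = trans (proj₁ (complementIfIn-fixes ind v x y Jy)) (ind x y Jx Jy)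

  complementIfIn-loopless : ∀ {K} → Loopless K → ∀ v → Loopless (complementIfIn K v)
  complementIfIn-loopless {K} lp v x with J v
  ... | true  = ∗v-diagonal K v x
  ... | false = lp x

  -- _∗_ folds over allFin n = tabulate id; an arbitrary σ makes the induction go through.
  foldl-closed-form : ∀ {m} (σ : Fin m → Fin n) (K : Adj n) → Independent K J → ∀ {x y} → x ≢ y →
    foldl complementIfIn K (tabulate σ) x y ≡ K x y xor ∑[ i < m ] (J (σ i) ∧ (K x (σ i) ∧ K (σ i) y))
  foldl-closed-form {zero}  σ K ind {x} {y} x≢y = sym (xor-identityʳ (K x y))
  foldl-closed-form {suc m} σ K ind {x} {y} x≢y = begin
    foldl complementIfIn K′ (tabulate (σ ∘ suc)) x y
      ≡⟨ foldl-closed-form (σ ∘ suc) K′ (complementIfIn-independent ind (σ zero)) x≢y ⟩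
    K′ x y xor ∑[ i < m ] (J (σ (suc i)) ∧ (K′ x (σ (suc i)) ∧ K′ (σ (suc i)) y))
      ≡⟨ cong₂ _xor_ (complementIfIn-off-diagonal K (σ zero) x≢y)
                     (∑-cong-on (J ∘ σ ∘ suc) _ _ λ i Ji →
                        cong₂ _∧_ (proj₁ (complementIfIn-fixes ind (σ zero) x (σ (suc i)) Ji))
                                  (proj₂ (complementIfIn-fixes ind (σ zero) y (σ (suc i)) Ji))) ⟩
    (K x y xor (J (σ zero) ∧ (K x (σ zero) ∧ K (σ zero) y))) xor
      ∑[ i < m ] (J (σ (suc i)) ∧ (K x (σ (suc i)) ∧ K (σ (suc i)) y))
      ≡⟨ xor-assoc (K x y) _ _ ⟩
    K x y xor ∑[ i < suc m ] (J (σ i) ∧ (K x (σ i) ∧ K (σ i) y)) ∎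
    where
    open ≡-Reasoning
    K′ = complementIfIn K (σ zero)

∗-closed-form : ∀ {n} {K : Adj n} {J} → Independent K J → ∀ {x y} → x ≢ y →
                (K ∗ J) x y ≡ K x y xor pathsThrough K J x y
∗-closed-form {K = K} {J} ind = LocalComplementation.foldl-closed-form J id K ind

∗-loopless : ∀ {n} {K : Adj n} J → Loopless K → Loopless (K ∗ J)
∗-loopless {n} J = foldl-preserves Loopless (λ v lp → complementIfIn-loopless lp v) (allFin n)
  where open LocalComplementation J

∗-cong : ∀ {n} {K K′ : Adj n} J → K ≈ K′ → (K ∗ J) ≈ (K′ ∗ J)
∗-cong {n} J = foldl-preserves₂ _≈_ step (allFin n)
  where
  open LocalComplementation J
  step : ∀ {K K′} v → K ≈ K′ → complementIfIn K v ≈ complementIfIn K′ v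
  step v K≈K′ x y with J v
  ... | true  rewrite K≈K′ x y | K≈K′ x v | K≈K′ v y = refl
  ... | false = K≈K′ x y

∗-empty : ∀ {n} {J : VSet n} → (∀ v → J v ≡ false) → ∀ K → (K ∗ J) ≈ K
∗-empty {n} {J} J≡∅ K = foldl-preserves (_≈ K) step (allFin n) (λ _ _ → refl)
  where
  open LocalComplementation J
  step : ∀ {H} v → H ≈ K → complementIfIn H v ≈ K
  step v H≈K rewrite J≡∅ v = H≈K

module _ {n : ℕ} where

  applyList : List (VSet n) → Adj n → Adj n
  applyList Js = applyParts (length Js) (lookup Js)

  AllIndependentList : List (VSet n) → Adj n → Set
  AllIndependentList Js = AllIndependent (length Js) (lookup Js)

  NonEmpty : VSet n → Set
  NonEmpty J = ∃[ v ] J v ≡ true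

  nonEmpty? : Decidable NonEmpty
  nonEmpty? J = any? λ v → J v ≟ᵇ true

  ¬NonEmpty⇒empty : {J : VSet n} → ¬ NonEmpty J → ∀ v → J v ≡ false
  ¬NonEmpty⇒empty {J} J≡∅ v with J v in Jv
  ... | true  = contradiction (v , Jv) J≡∅
  ... | false = refl

  dropEmpty : List (VSet n) → List (VSet n)
  dropEmpty = filter nonEmpty?

  applyList-dropEmpty : ∀ Js {K K′} → K ≈ K′ → applyList Js K ≈ applyList (dropEmpty Js) K′
  applyList-dropEmpty []       K≈K′ = K≈K′
  applyList-dropEmpty (J ∷ Js) {K} K≈K′ with nonEmpty? J
  ... | yes _   = applyList-dropEmpty Js (∗-cong J K≈K′)
  ... | no  J≡∅ = applyList-dropEmpty Js λ x y →
                    trans (∗-empty (¬NonEmpty⇒empty J≡∅) K x y) (K≈K′ x y)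

  allIndependent-dropEmpty : ∀ Js {K K′} → K ≈ K′ →
                             AllIndependentList Js K → AllIndependentList (dropEmpty Js) K′
  allIndependent-dropEmpty []       K≈K′ _ = tt
  allIndependent-dropEmpty (J ∷ Js) {K} K≈K′ (indJ , indJs) with nonEmpty? J
  ... | yes _   = (λ x y Jx Jy → trans (sym (K≈K′ x y)) (indJ x y Jx Jy)) ,
                  allIndependent-dropEmpty Js (∗-cong J K≈K′) indJs
  ... | no  J≡∅ = allIndependent-dropEmpty Js
                    (λ x y → trans (∗-empty (¬NonEmpty⇒empty J≡∅) K x y) (K≈K′ x y)) indJs

  Disjoint : VSet n → VSet n → Set
  Disjoint J J′ = ∀ v → J v ≡ true → J′ v ≡ true → ⊥

  lookup-disjoint : ∀ {Js} → AllPairs Disjoint Js →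
                    ∀ i j v → lookup Js i v ≡ true → lookup Js j v ≡ true → i ≡ j
  lookup-disjoint (_ ∷ _) zero zero v _ _ = refl
  lookup-disjoint (J# ∷ _) zero (suc j) v Jv J′v = contradiction J′v (All.lookup J# (∈-lookup j) v Jv)
  lookup-disjoint (J# ∷ _) (suc i) zero v J′v Jv = contradiction J′v (All.lookup J# (∈-lookup i) v Jv)
  lookup-disjoint (_ ∷ Js#) (suc i) (suc j) v Jv J′v = cong suc (lookup-disjoint Js# i j v Jv J′v)

  _⊆_ : VSet n → VSet n → Set
  J ⊆ I = ∀ v → J v ≡ true → I v ≡ true

  dropEmpty-partition : ∀ {I} Js → All (_⊆ I) Js → (∀ v → I v ≡ true → Any (λ J → J v ≡ true) Js) →
                        AllPairs Disjoint Js → IsPartition I (lookup (dropEmpty Js))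
  dropEmpty-partition {I} Js Js⊆I covers disjoint = record
    { nonempty = λ i → All.lookup (All.all-filter nonEmpty? Js) (∈-lookup i)
    ; subset   = λ i → All.lookup (All.filter⁺ nonEmpty? Js⊆I) (∈-lookup i)
    ; cover    = cover
    ; disjoint = lookup-disjoint (AllPairs.filter⁺ nonEmpty? disjoint)
    }
    where
    cover : ∀ v → I v ≡ true → ∃[ i ] lookup (dropEmpty Js) i v ≡ true
    cover v Iv with Any.filter⁺ nonEmpty? (covers v Iv)
    ... | inj₁ v∈Js′ = Any.index v∈Js′ , lookup-index v∈Js′
    ... | inj₂ ∅     = contradiction (v , lookup-result (covers v Iv)) ∅

module ShapeInvariant {n : ℕ} (A : Adj n) (A-sym : ∀ x y → A x y ≡ A y x)
                      (I : VSet n) (I-indep : Independent A I)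
                      {k : ℕ} (ι : Fin n → Fin k) {Code : Set} (code : Fin n → Code) where

  Pending : VSet n → Fin n → Set
  Pending P x = I x ≡ true × P x ≡ false

  -- closed-form says that K is A ∗ P followed by the flip Φ of the codes (∗-closed-form, as P ⊆ I is
  -- independent in A). classwise is what makes the rest of a class independent once we have
  -- complemented at its leader.
  record Shape (K : Adj n) (P : VSet n) (Φ : Code → Code → Bool) : Set where
    field
      loopless    : Loopless K
      processed   : P ⊆ I
      classwise   : ∀ {x y x′ y′} → Pending P x → Pending P y → Pending P x′ → Pending P y′ →
                    ι x ≡ ι x′ → ι y ≡ ι y′ → x ≢ y → x′ ≢ y′ → K x y ≡ K x′ y′
      closed-form : ∀ {x y} → x ≢ y → K x y ≡ (A x y xor pathsThrough A P x y) xor Φ (code x) (code y)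
      Φ-sym       : ∀ l m → Φ l m ≡ Φ m l

  -- If K x v = A x v + α and K v y = A v y + β for v ∈ J, then Σ_{v ∈ J} K x v K v y is
  -- pathsThrough A J x y + α · parity A J y + β · parity A J x + α β |J|.
  updateΦ : (inJ par : Code → Bool) (size : Bool) (l₀ : Code) →
            (Code → Code → Bool) → Code → Code → Bool
  updateΦ inJ par size l₀ Φ l m =
    Φ l m xor ((not (inJ l) ∧ not (inJ m)) ∧
               (((Φ l l₀ ∧ par m) xor (Φ l₀ m ∧ par l)) xor ((Φ l l₀ ∧ Φ l₀ m) ∧ size)))

  updateΦ-sym : ∀ inJ par size l₀ Φ → (∀ l m → Φ l m ≡ Φ m l) → ∀ l m →
                updateΦ inJ par size l₀ Φ l m ≡ updateΦ inJ par size l₀ Φ m l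
  updateΦ-sym inJ par size l₀ Φ Φ-sym l m
    rewrite Φ-sym l m | Φ-sym l l₀ | Φ-sym l₀ m =
    cong (Φ m l xor_) (swap (not (inJ l)) (not (inJ m)) (Φ l₀ l) (Φ m l₀) (par l) (par m) size)
    where
    swap : ∀ a b α β p q z → (a ∧ b) ∧ (((α ∧ q) xor (β ∧ p)) xor ((α ∧ β) ∧ z))
                           ≡ (b ∧ a) ∧ (((β ∧ p) xor (α ∧ q)) xor ((β ∧ α) ∧ z))
    swap = solve-∀ GF2

  updateΦ-inside : ∀ inJ par size l₀ Φ {l m} → inJ l ≡ true ⊎ inJ m ≡ true →
                   updateΦ inJ par size l₀ Φ l m ≡ Φ l m
  updateΦ-inside inJ par size l₀ Φ {l} {m} (inj₁ l∈J) rewrite l∈J = xor-identityʳ (Φ l m)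
  updateΦ-inside inJ par size l₀ Φ {l} {m} (inj₂ m∈J)
    rewrite m∈J | ∧-zeroʳ (not (inJ l)) = xor-identityʳ (Φ l m)

  updateΦ-outside : ∀ inJ par size l₀ Φ {l m} → inJ l ≡ false → inJ m ≡ false →
    updateΦ inJ par size l₀ Φ l m ≡
    Φ l m xor (((Φ l l₀ ∧ par m) xor (Φ l₀ m ∧ par l)) xor ((Φ l l₀ ∧ Φ l₀ m) ∧ size))
  updateΦ-outside inJ par size l₀ Φ l∉J m∉J rewrite l∉J | m∉J = refl

  module Step {K P Φ} (S : Shape K P Φ) {J : VSet n} (J-pending : ∀ v → J v ≡ true → Pending P v)
              (J-indep : Independent K J) {l₀ : Code} (J-code : ∀ v → J v ≡ true → code v ≡ l₀)
              {inJ par : Code → Bool} (inJ-code : ∀ x → inJ (code x) ≡ J x)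
              (par-code : ∀ x → par (code x) ≡ parity A J x) where
    open Shape S

    P′ : VSet n
    P′ v = P v xor J v

    size : Bool
    size = ∑[ v < n ] J v

    Φ′ : Code → Code → Bool
    Φ′ = updateΦ inJ par size l₀ Φ

    processed′ : P′ ⊆ I
    processed′ v P′v with P v in Pv | J v in Jv
    ... | true  | _    = processed v Pv
    ... | false | true = proj₁ (J-pending v Jv)
    ... | false | false with () ← P′v

    pending-split : ∀ {x} → Pending P′ x → Pending P x × J x ≡ false
    pending-split {x} (Ix , P′x) with J x in Jx
    ... | false = (Ix , trans (sym (xor-identityʳ (P x))) P′x) , refl
    ... | true  = contradiction (trans (sym (cong (_xor true) (proj₂ (J-pending x Jx)))) P′x) λ ()

    J⊆I : ∀ {v} → J v ≡ true → I v ≡ true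
    J⊆I {v} Jv = proj₁ (J-pending v Jv)

    apart : ∀ {x v} → J x ≡ false → J v ≡ true → x ≢ v
    apart Jx Jv refl = contradiction (trans (sym Jx) Jv) λ ()

    classwise′ : ∀ {x y x′ y′} → Pending P′ x → Pending P′ y → Pending P′ x′ → Pending P′ y′ →
                 ι x ≡ ι x′ → ι y ≡ ι y′ → x ≢ y → x′ ≢ y′ → (K ∗ J) x y ≡ (K ∗ J) x′ y′
    classwise′ {x} {y} {x′} {y′} px py px′ py′ ιx ιy x≢y x′≢y′ = begin
      (K ∗ J) x y                    ≡⟨ ∗-closed-form J-indep x≢y ⟩
      K x y xor pathsThrough K J x y
        ≡⟨ cong₂ _xor_ (classwise x₀ y₀ x′₀ y′₀ ιx ιy x≢y x′≢y′)
                       (∑-cong-on J _ _ λ v Jv → cong₂ _∧_ (rows v Jv) (columns v Jv)) ⟩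
      K x′ y′ xor pathsThrough K J x′ y′ ≡⟨ sym (∗-closed-form J-indep x′≢y′) ⟩
      (K ∗ J) x′ y′                  ∎
      where
      open ≡-Reasoning
      x₀ = proj₁ (pending-split px)
      y₀ = proj₁ (pending-split py)
      x′₀ = proj₁ (pending-split px′)
      y′₀ = proj₁ (pending-split py′)
      rows : ∀ v → J v ≡ true → K x v ≡ K x′ v
      rows v Jv = classwise x₀ (J-pending v Jv) x′₀ (J-pending v Jv) ιx refl
                    (apart (proj₂ (pending-split px)) Jv) (apart (proj₂ (pending-split px′)) Jv)
      columns : ∀ v → J v ≡ true → K v y ≡ K v y′
      columns v Jv = classwise (J-pending v Jv) y₀ (J-pending v Jv) y′₀ refl ιy
                       (apart (proj₂ (pending-split py)) Jv ∘ sym)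
                       (apart (proj₂ (pending-split py′)) Jv ∘ sym)

    closed-form-trivial : ∀ {x y} → x ≢ y → pathsThrough K J x y ≡ false → pathsThrough A J x y ≡ false →
                Φ′ (code x) (code y) ≡ Φ (code x) (code y) →
                (K ∗ J) x y ≡ (A x y xor pathsThrough A P′ x y) xor Φ′ (code x) (code y)
    closed-form-trivial {x} {y} x≢y K-paths A-paths Φ′≡Φ = begin
      (K ∗ J) x y                                            ≡⟨ ∗-closed-form J-indep x≢y ⟩
      K x y xor pathsThrough K J x y                         ≡⟨ cong (K x y xor_) K-paths ⟩
      K x y xor false                                        ≡⟨ xor-identityʳ (K x y) ⟩
      K x y                                                  ≡⟨ closed-form x≢y ⟩
      (A x y xor pathsThrough A P x y) xor Φ (code x) (code y)
        ≡⟨ cong₂ (λ p φ → (A x y xor p) xor φ)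
                 (sym (trans (pathsThrough-xor A P J x y)
                             (trans (cong (pathsThrough A P x y xor_) A-paths) (xor-identityʳ _))))
                 (sym Φ′≡Φ) ⟩
      (A x y xor pathsThrough A P′ x y) xor Φ′ (code x) (code y) ∎
      where open ≡-Reasoning

    row : ∀ {x} v → J x ≡ false → J v ≡ true → K x v ≡ A x v xor Φ (code x) l₀
    row {x} v Jx Jv = begin
      K x v
        ≡⟨ closed-form (apart Jx Jv) ⟩
      (A x v xor pathsThrough A P x v) xor Φ (code x) (code v)
        ≡⟨ cong₂ (λ p c → (A x v xor p) xor Φ (code x) c)
                 (pathsThrough-vanishʳ A P x λ u Pu → I-indep u v (processed u Pu) (J⊆I Jv))
                 (J-code v Jv) ⟩
      (A x v xor false) xor Φ (code x) l₀
        ≡⟨ cong (_xor Φ (code x) l₀) (xor-identityʳ (A x v)) ⟩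
      A x v xor Φ (code x) l₀ ∎
      where open ≡-Reasoning

    column : ∀ {y} v → J y ≡ false → J v ≡ true → K v y ≡ A v y xor Φ l₀ (code y)
    column {y} v Jy Jv = begin
      K v y
        ≡⟨ closed-form (apart Jy Jv ∘ sym) ⟩
      (A v y xor pathsThrough A P v y) xor Φ (code v) (code y)
        ≡⟨ cong₂ (λ p c → (A v y xor p) xor Φ c (code y))
                 (pathsThrough-vanishˡ A P y λ u Pu → I-indep v u (J⊆I Jv) (processed u Pu))
                 (J-code v Jv) ⟩
      (A v y xor false) xor Φ l₀ (code y)
        ≡⟨ cong (_xor Φ l₀ (code y)) (xor-identityʳ (A v y)) ⟩
      A v y xor Φ l₀ (code y) ∎
      where open ≡-Reasoning

    paths-expansion : ∀ {x y} → J x ≡ false → J y ≡ false →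
      pathsThrough K J x y ≡
        (pathsThrough A J x y xor (Φ l₀ (code y) ∧ parity A J x)) xor
        ((Φ (code x) l₀ ∧ parity A J y) xor ((Φ (code x) l₀ ∧ Φ l₀ (code y)) ∧ size))
    paths-expansion {x} {y} Jx Jy = begin
      ∑[ v < n ] (J v ∧ (K x v ∧ K v y))
        ≡⟨ ∑-cong-on J _ _ (λ v Jv → cong₂ _∧_ (row v Jx Jv) (column v Jy Jv)) ⟩
      ∑[ v < n ] (J v ∧ ((A x v xor α) ∧ (A v y xor β)))
        ≡⟨ sum-cong-≗ (λ v → expand (J v) (A x v) (A v y) α β) ⟩
      ∑[ v < n ] (((J v ∧ (A x v ∧ A v y)) xor (β ∧ (J v ∧ A x v))) xor
                  ((α ∧ (J v ∧ A v y)) xor ((α ∧ β) ∧ J v)))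
        ≡⟨ ∑-xor₄ (λ v → J v ∧ (A x v ∧ A v y)) (λ v → β ∧ (J v ∧ A x v))
                  (λ v → α ∧ (J v ∧ A v y)) (λ v → (α ∧ β) ∧ J v) ⟩
      (pathsThrough A J x y xor ∑[ v < n ] (β ∧ (J v ∧ A x v))) xor
        (∑[ v < n ] (α ∧ (J v ∧ A v y)) xor ∑[ v < n ] ((α ∧ β) ∧ J v))
        ≡⟨ cong₂ (λ p q → (pathsThrough A J x y xor p) xor q)
                 (∑-scale β (λ v → J v ∧ A x v))
                 (cong₂ _xor_ (trans (∑-scale α (λ v → J v ∧ A v y))
                                     (cong (α ∧_) (sum-cong-≗ λ v → cong (J v ∧_) (A-sym v y))))
                              (∑-scale (α ∧ β) J)) ⟩
      (pathsThrough A J x y xor (β ∧ parity A J x)) xor ((α ∧ parity A J y) xor ((α ∧ β) ∧ size)) ∎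
      where
      open ≡-Reasoning
      α = Φ (code x) l₀
      β = Φ l₀ (code y)
      expand : ∀ j a b α β → j ∧ ((a xor α) ∧ (b xor β)) ≡
               ((j ∧ (a ∧ b)) xor (β ∧ (j ∧ a))) xor ((α ∧ (j ∧ b)) xor ((α ∧ β) ∧ j))
      expand = solve-∀ GF2

    closed-form-outside : ∀ {x y} → x ≢ y → J x ≡ false → J y ≡ false →
              (K ∗ J) x y ≡ (A x y xor pathsThrough A P′ x y) xor Φ′ (code x) (code y)
    closed-form-outside {x} {y} x≢y Jx Jy = begin
      (K ∗ J) x y                    ≡⟨ ∗-closed-form J-indep x≢y ⟩
      K x y xor pathsThrough K J x y ≡⟨ cong₂ _xor_ (closed-form x≢y) (paths-expansion Jx Jy) ⟩
      ((A x y xor pathsThrough A P x y) xor φ) xor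
        ((pathsThrough A J x y xor (β ∧ parity A J x)) xor ((α ∧ parity A J y) xor ((α ∧ β) ∧ size)))
        ≡⟨ regroup (A x y) (pathsThrough A P x y) φ (pathsThrough A J x y)
                   (β ∧ parity A J x) (α ∧ parity A J y) ((α ∧ β) ∧ size) ⟩
      (A x y xor (pathsThrough A P x y xor pathsThrough A J x y)) xor
        (φ xor (((α ∧ parity A J y) xor (β ∧ parity A J x)) xor ((α ∧ β) ∧ size)))
        ≡⟨ cong₂ (λ p u → (A x y xor p) xor u) (sym (pathsThrough-xor A P J x y)) (sym Φ′-outside) ⟩
      (A x y xor pathsThrough A P′ x y) xor Φ′ (code x) (code y) ∎
      where
      open ≡-Reasoning
      φ = Φ (code x) (code y)
      α = Φ (code x) l₀
      β = Φ l₀ (code y)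
      regroup : ∀ a p φ q r s t → ((a xor p) xor φ) xor ((q xor r) xor (s xor t)) ≡
                                  (a xor (p xor q)) xor (φ xor ((s xor r) xor t))
      regroup = solve-∀ GF2
      Φ′-outside : Φ′ (code x) (code y) ≡
                   φ xor (((α ∧ parity A J y) xor (β ∧ parity A J x)) xor ((α ∧ β) ∧ size))
      Φ′-outside = trans (updateΦ-outside inJ par size l₀ Φ (trans (inJ-code x) Jx) (trans (inJ-code y) Jy))
                         (cong₂ (λ p q → φ xor (((α ∧ p) xor (β ∧ q)) xor ((α ∧ β) ∧ size)))
                                (par-code y) (par-code x))

    closed-form′ : ∀ {x y} → x ≢ y →
                   (K ∗ J) x y ≡ (A x y xor pathsThrough A P′ x y) xor Φ′ (code x) (code y)
    closed-form′ {x} {y} x≢y with J x in Jx | J y in Jy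
    ... | true  | _     = closed-form-trivial x≢y (pathsThrough-vanishˡ K J y λ v Jv → J-indep x v Jx Jv)
                                        (pathsThrough-vanishˡ A J y λ v Jv → I-indep x v (J⊆I Jx) (J⊆I Jv))
                                        (updateΦ-inside inJ par size l₀ Φ (inj₁ (trans (inJ-code x) Jx)))
    ... | false | true  = closed-form-trivial x≢y (pathsThrough-vanishʳ K J x λ v Jv → J-indep v y Jv Jy)
                                        (pathsThrough-vanishʳ A J x λ v Jv → I-indep v y (J⊆I Jv) (J⊆I Jy))
                                        (updateΦ-inside inJ par size l₀ Φ (inj₂ (trans (inJ-code y) Jy)))
    ... | false | false = closed-form-outside x≢y Jx Jy

    shape : Shape (K ∗ J) P′ Φ′
    shape = record
      { loopless    = ∗-loopless J loopless
      ; processed   = processed′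
      ; classwise   = classwise′
      ; closed-form = closed-form′
      ; Φ-sym       = updateΦ-sym inJ par size l₀ Φ Φ-sym
      }

-- Splitting the classes and labelling the vertices

∧-not-true : ∀ {a b} → a ∧ not b ≡ true → a ≡ true × b ≡ false
∧-not-true {true} {false} _ = refl , refl

funToFin-cong : ∀ {m n} {f g : Fin m → Fin n} → (∀ i → f i ≡ g i) → funToFin f ≡ funToFin g
funToFin-cong {zero}  f≗g = refl
funToFin-cong {suc m} f≗g = cong₂ combine (f≗g zero) (funToFin-cong (f≗g ∘ suc))

module _ {n : ℕ} where

  leaderOf : {J : VSet n} → Dec (NonEmpty J) → VSet n
  leaderOf (yes (v₀ , _)) v = does (v₀ ≟ v)
  leaderOf (no _)         v = false

  leaderOf-⊆ : ∀ {J} (J? : Dec (NonEmpty J)) → leaderOf J? ⊆ J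
  leaderOf-⊆ (yes (v₀ , Jv₀)) v v∈ with v₀ ≟ v
  ... | yes refl = Jv₀
  leaderOf-⊆ (no _) v ()

  leaderOf-unique : ∀ {J} (J? : Dec (NonEmpty J)) {x y} →
                    leaderOf J? x ≡ true → leaderOf J? y ≡ true → x ≡ y
  leaderOf-unique (yes (v₀ , _)) {x} {y} x∈ y∈ with v₀ ≟ x | v₀ ≟ y
  ... | yes refl | yes refl = refl
  leaderOf-unique (no _) ()

  leaderOf-independent : ∀ {J K} (J? : Dec (NonEmpty J)) → Loopless K → Independent K (leaderOf J?)
  leaderOf-independent J? lp x y x∈ y∈ rewrite leaderOf-unique J? x∈ y∈ = lp y

module Construction {n : ℕ} (G : Adj n) (G-graph : IsGraph G) (I : VSet n) (I-indep : Independent G I)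
                    {k : ℕ} (F : Flip n k) where

  open Flip F using (ι; τ)

  classMembers : Fin k → VSet n
  classMembers c v = does (ι v ≟ c) ∧ I v

  classMembers-ι : ∀ {c v} → classMembers c v ≡ true → ι v ≡ c
  classMembers-ι {c} {v} v∈ with ι v ≟ c
  ... | yes ιv≡c = ιv≡c

  classMembers-I : ∀ {c v} → classMembers c v ≡ true → I v ≡ true
  classMembers-I {c} {v} v∈ with ι v ≟ c
  ... | yes _ = v∈

  first : Fin k → VSet n
  first c = leaderOf (nonEmpty? (classMembers c))

  rest : Fin k → VSet n
  rest c v = classMembers c v ∧ not (first c v)

  part : Fin k → Fin 2 → VSet n
  part c zero       = first c
  part c (suc zero) = rest c

  rest-⊆ : ∀ c → rest c ⊆ classMembers c
  rest-⊆ c v v∈ with classMembers c v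
  ... | true = refl

  part-⊆ : ∀ c s → part c s ⊆ classMembers c
  part-⊆ c zero       = leaderOf-⊆ (nonEmpty? (classMembers c))
  part-⊆ c (suc zero) = rest-⊆ c

  first-rest-disjoint : ∀ {c v} → first c v ≡ true → rest c v ≡ false
  first-rest-disjoint {c} {v} v∈ rewrite v∈ = ∧-zeroʳ (classMembers c v)

  part-unique : ∀ c s c′ s′ {v} → part c s v ≡ true → part c′ s′ v ≡ true → c ≡ c′ × s ≡ s′
  part-unique c s c′ s′ {v} v∈ v∈′
    with trans (sym (classMembers-ι (part-⊆ c s v v∈))) (classMembers-ι (part-⊆ c′ s′ v v∈′))
  ... | refl = refl , sides s s′ v∈ v∈′
    where
    sides : ∀ s s′ → part c s v ≡ true → part c s′ v ≡ true → s ≡ s′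
    sides zero       zero       _   _   = refl
    sides zero       (suc zero) v∈ v∈′ = contradiction (trans (sym (first-rest-disjoint v∈)) v∈′) λ ()
    sides (suc zero) zero       v∈ v∈′ = contradiction (trans (sym (first-rest-disjoint v∈′)) v∈) λ ()
    sides (suc zero) (suc zero) _   _   = refl

  first-xor-rest : ∀ c v → first c v xor rest c v ≡ classMembers c v
  first-xor-rest c v with first c v in v∈
  ... | true  = trans (cong (true xor_) (∧-zeroʳ (classMembers c v)))
                      (sym (leaderOf-⊆ (nonEmpty? (classMembers c)) v v∈))
  ... | false = ∧-identityʳ (classMembers c v)

  first-or-rest : ∀ {c v} → classMembers c v ≡ true → first c v ≡ true ⊎ rest c v ≡ true
  first-or-rest {c} {v} v∈ with first c v
  ... | true  = inj₁ refl
  ... | false = inj₂ (trans (∧-identityʳ _) v∈)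

  outside-class : ∀ {c c′ v} s → classMembers c′ v ≡ true → c′ ≢ c → part c s v ≡ false
  outside-class {c} {c′} {v} s v∈ c′≢c with part c s v in v∈′
  ... | true  = contradiction (trans (sym (classMembers-ι v∈)) (classMembers-ι (part-⊆ c s v v∈′))) c′≢c
  ... | false = refl

  feature : Fin k → Fin 2 → Fin 2 → VSet n
  feature c s zero       = part c s
  feature c s (suc zero) = parity G (part c s)

  -- 16 ^ k = ((2 ^ 2) ^ 2) ^ k: one bit for each class c, side s and feature t.
  Code : Set
  Code = Fin (k * 16 ^ k)

  code : Fin n → Code
  code x = combine (ι x) (funToFin λ c → funToFin λ s → funToFin λ t → 2↔Bool.from (feature c s t x))

  classAt : Code → Fin k
  classAt = quotient (16 ^ k)

  featureAt : Fin k → Fin 2 → Fin 2 → Code → Bool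
  featureAt c s t l = 2↔Bool.to (finToFun (finToFun (finToFun (remainder {k} (16 ^ k) l) c) s) t)

  classAt-code : ∀ x → classAt (code x) ≡ ι x
  classAt-code x = cong proj₁ (remQuot-combine (ι x) _)

  featureAt-code : ∀ c s t x → featureAt c s t (code x) ≡ feature c s t x
  featureAt-code c s t x = begin
    featureAt c s t (code x)
      ≡⟨ cong (λ l → 2↔Bool.to (finToFun (finToFun (finToFun l c) s) t))
              (cong proj₂ (remQuot-combine (ι x) _)) ⟩
    2↔Bool.to (finToFun (finToFun (finToFun (funToFin λ c → funToFin λ s → funToFin λ t → bit c s t) c) s) t)
      ≡⟨ cong (λ f → 2↔Bool.to (finToFun (finToFun f s) t))
              (finToFun-funToFin (λ c′ → funToFin λ s′ → funToFin (bit c′ s′)) c) ⟩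
    2↔Bool.to (finToFun (finToFun (funToFin λ s → funToFin λ t → bit c s t) s) t)
      ≡⟨ cong (λ f → 2↔Bool.to (finToFun f t)) (finToFun-funToFin (λ s′ → funToFin (bit c s′)) s) ⟩
    2↔Bool.to (finToFun (funToFin λ t → bit c s t) t)
      ≡⟨ cong 2↔Bool.to (finToFun-funToFin (bit c s) t) ⟩
    2↔Bool.to (bit c s t)
      ≡⟨ 2↔Bool.strictlyInverseˡ (feature c s t x) ⟩
    feature c s t x ∎
    where
    open ≡-Reasoning
    bit : Fin k → Fin 2 → Fin 2 → Fin 2
    bit c s t = 2↔Bool.from (feature c s t x)

  partFeature : Fin k → Fin 2 → Fin k → Fin 2 → Fin 2 → Bool
  partFeature c₀ s₀ c s zero       = does (c₀ ≟ c) ∧ does (s₀ ≟ s)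
  partFeature c₀ s₀ c s (suc zero) = false

  partCode : Fin k → Fin 2 → Code
  partCode c₀ s₀ =
    combine c₀ (funToFin λ c → funToFin λ s → funToFin λ t → 2↔Bool.from (partFeature c₀ s₀ c s t))

  part-indicator : ∀ c₀ s₀ {v} → part c₀ s₀ v ≡ true →
                   ∀ c s → part c s v ≡ does (c₀ ≟ c) ∧ does (s₀ ≟ s)
  part-indicator c₀ s₀ {v} v∈ c s with part c s v in v∈′ | c₀ ≟ c | s₀ ≟ s
  ... | true  | yes _    | yes _    = refl
  ... | true  | no c₀≢c  | _        = contradiction (proj₁ (part-unique c₀ s₀ c s v∈ v∈′)) c₀≢c
  ... | true  | yes _    | no s₀≢s  = contradiction (proj₂ (part-unique c₀ s₀ c s v∈ v∈′)) s₀≢s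
  ... | false | yes refl | yes refl = contradiction (trans (sym v∈′) v∈) λ ()
  ... | false | yes _    | no _     = refl
  ... | false | no _     | _        = refl

  parity-of-I : ∀ {J v} → J ⊆ I → I v ≡ true → parity G J v ≡ false
  parity-of-I {J} {v} J⊆I Iv = ∑-zero _ λ u → ∧-guarded-zero (J u) λ Ju → I-indep v u Iv (J⊆I u Ju)

  part-⊆-I : ∀ c s → part c s ⊆ I
  part-⊆-I c s v v∈ = classMembers-I (part-⊆ c s v v∈)

  part-code : ∀ c₀ s₀ {v} → part c₀ s₀ v ≡ true → code v ≡ partCode c₀ s₀
  part-code c₀ s₀ {v} v∈ =
    cong₂ combine (classMembers-ι (part-⊆ c₀ s₀ v v∈))
                  (funToFin-cong λ c → funToFin-cong λ s → funToFin-cong λ t →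
                     cong 2↔Bool.from (features c s t))
    where
    features : ∀ c s t → feature c s t v ≡ partFeature c₀ s₀ c s t
    features c s zero       = part-indicator c₀ s₀ v∈ c s
    features c s (suc zero) = parity-of-I (part-⊆-I c s) (part-⊆-I c₀ s₀ v v∈)

  open ShapeInvariant G (IsGraph.sym G-graph) I I-indep ι code

  ClassPending : VSet n → Fin k → Set
  ClassPending P c = ∀ v → classMembers c v ≡ true → Pending P v

  afterPart : Fin k → Fin 2 → (Code → Code → Bool) → Code → Code → Bool
  afterPart c s = updateΦ (featureAt c s zero) (featureAt c s (suc zero)) (∑[ v < n ] part c s v) (partCode c s)

  shape-part : ∀ {K P Φ} c s → Shape K P Φ →
               (∀ v → part c s v ≡ true → Pending P v) → Independent K (part c s) →
               Shape (K ∗ part c s) (λ v → P v xor part c s v) (afterPart c s Φ)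
  shape-part c s S pending indep =
    Step.shape S pending indep (λ v → part-code c s {v}) {featureAt c s zero} {featureAt c s (suc zero)}
               (featureAt-code c s zero) (featureAt-code c s (suc zero))

  rest-independent : ∀ {K P Φ} c → Shape K P Φ → ClassPending P c → Independent (K ∗ first c) (rest c)
  rest-independent {K} c S pending x y x∈ y∈ with x ≟ y
  ... | yes refl = ∗-loopless (first c) (Shape.loopless S) x
  ... | no  x≢y  = complement-at-leader (nonEmpty? (classMembers c)) x∈ y∈
    where
    open Shape S
    complement-at-leader : (d : Dec (NonEmpty (classMembers c))) →
      classMembers c x ∧ not (leaderOf d x) ≡ true → classMembers c y ∧ not (leaderOf d y) ≡ true →
      (K ∗ leaderOf d) x y ≡ false
    complement-at-leader (no ∅) x∈ _ = contradiction (x , proj₁ (∧-not-true x∈)) ∅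
    complement-at-leader (yes (v₀ , v₀∈)) x∈ y∈ = begin
      (K ∗ leaderOf d₀) x y                      ≡⟨ ∗-closed-form (leaderOf-independent d₀ loopless) x≢y ⟩
      K x y xor pathsThrough K (leaderOf d₀) x y ≡⟨ cong (K x y xor_) (∑-select v₀ _) ⟩
      K x y xor (K x v₀ ∧ K v₀ y)                ≡⟨ cong₂ (λ a b → K x y xor (a ∧ b)) Kxv₀ Kv₀y ⟩
      K x y xor (K x y ∧ K x y)                  ≡⟨ cong (K x y xor_) (∧-idem (K x y)) ⟩
      K x y xor K x y                            ≡⟨ xor-same (K x y) ⟩
      false                                      ∎
      where
      open ≡-Reasoning
      d₀ : Dec (NonEmpty (classMembers c))
      d₀ = yes (v₀ , v₀∈)
      x∈c = proj₁ (∧-not-true x∈)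
      y∈c = proj₁ (∧-not-true y∈)
      apart : ∀ {w} → does (v₀ ≟ w) ≡ false → v₀ ≢ w
      apart v₀≠w v₀≡w = contradiction (trans (sym (dec-true (v₀ ≟ _) v₀≡w)) v₀≠w) λ ()
      Kxv₀ : K x v₀ ≡ K x y
      Kxv₀ = classwise (pending x x∈c) (pending v₀ v₀∈) (pending x x∈c) (pending y y∈c) refl
                       (trans (classMembers-ι v₀∈) (sym (classMembers-ι y∈c)))
                       (apart (proj₂ (∧-not-true x∈)) ∘ sym) x≢y
      Kv₀y : K v₀ y ≡ K x y
      Kv₀y = classwise (pending v₀ v₀∈) (pending y y∈c) (pending x x∈c) (pending y y∈c)
                       (trans (classMembers-ι v₀∈) (sym (classMembers-ι x∈c))) refl
                       (apart (proj₂ (∧-not-true y∈))) x≢y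

  afterClass : Fin k → VSet n → VSet n
  afterClass c P v = (P v xor first c v) xor rest c v

  afterClassΦ : Fin k → (Code → Code → Bool) → Code → Code → Bool
  afterClassΦ c = afterPart c (suc zero) ∘ afterPart c zero

  shape-class : ∀ {K P Φ} c → Shape K P Φ → ClassPending P c →
    Shape ((K ∗ first c) ∗ rest c) (afterClass c P) (afterClassΦ c Φ) ×
    Independent K (first c) × Independent (K ∗ first c) (rest c)
  shape-class {K} {P} c S pending = shape-part c (suc zero) S₁ rest-pending rest-indep , first-indep , rest-indep
    where
    first-indep : Independent K (first c)
    first-indep = leaderOf-independent (nonEmpty? (classMembers c)) (Shape.loopless S)
    S₁ = shape-part c zero S (λ v v∈ → pending v (part-⊆ c zero v v∈)) first-indep
    rest-indep : Independent (K ∗ first c) (rest c)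
    rest-indep = rest-independent c S pending
    rest-pending : ∀ v → rest c v ≡ true → Pending (λ u → P u xor first c u) v
    rest-pending v v∈ with pending v (rest-⊆ c v v∈) | proj₂ (∧-not-true {classMembers c v} v∈)
    ... | Iv , Pv | first∌v rewrite Pv | first∌v = Iv , refl

  pending-afterClass : ∀ {P c c′} → ClassPending P c′ → c′ ≢ c → ClassPending (afterClass c P) c′
  pending-afterClass {P} {c} pending c′≢c v v∈ =
    proj₁ (pending v v∈) ,
    (begin
      (P v xor first c v) xor rest c v ≡⟨ cong₂ (λ a b → (P v xor a) xor b)
                                                (outside-class zero v∈ c′≢c) (outside-class (suc zero) v∈ c′≢c) ⟩
      (P v xor false) xor false       ≡⟨ trans (xor-identityʳ _) (xor-identityʳ (P v)) ⟩
      P v                             ≡⟨ proj₂ (pending v v∈) ⟩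
      false                           ∎)
    where open ≡-Reasoning

  partsOf : ∀ {m} → (Fin m → Fin k) → List (VSet n)
  partsOf {zero}  σ = []
  partsOf {suc m} σ = first (σ zero) ∷ rest (σ zero) ∷ partsOf (σ ∘ suc)

  parts : List (VSet n)
  parts = partsOf id

  processedAfter : ∀ {m} → (Fin m → Fin k) → VSet n → VSet n
  processedAfter {zero}  σ P = P
  processedAfter {suc m} σ P = processedAfter (σ ∘ suc) (afterClass (σ zero) P)

  ΦAfter : ∀ {m} → (Fin m → Fin k) → (Code → Code → Bool) → Code → Code → Bool
  ΦAfter {zero}  σ Φ = Φ
  ΦAfter {suc m} σ Φ = ΦAfter (σ ∘ suc) (afterClassΦ (σ zero) Φ)

  shape-classes : ∀ {m} (σ : Fin m → Fin k) → Injective _≡_ _≡_ σ → ∀ {K P Φ} → Shape K P Φ →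
    (∀ i → ClassPending P (σ i)) →
    Shape (applyList (partsOf σ) K) (processedAfter σ P) (ΦAfter σ Φ) × AllIndependentList (partsOf σ) K
  shape-classes {zero}  σ σ-inj S pending = S , tt
  shape-classes {suc m} σ σ-inj {K} {P} {Φ} S pending with shape-class (σ zero) S (pending zero)
  ... | S′ , first-indep , rest-indep with shape-classes (σ ∘ suc) (suc-injective ∘ σ-inj) S′ pending′
    where
    pending′ : ∀ i → ClassPending (afterClass (σ zero) P) (σ (suc i))
    pending′ i = pending-afterClass (pending (suc i)) λ σi≡σ0 → contradiction (σ-inj σi≡σ0) λ ()
  ...   | S″ , indeps = S″ , first-indep , rest-indep , indeps

  processedAfter-members : ∀ {m} (σ : Fin m → Fin k) P v →
    processedAfter σ P v ≡ P v xor ∑[ i < m ] classMembers (σ i) v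
  processedAfter-members {zero}  σ P v = sym (xor-identityʳ (P v))
  processedAfter-members {suc m} σ P v = begin
    processedAfter (σ ∘ suc) (afterClass (σ zero) P) v
      ≡⟨ processedAfter-members (σ ∘ suc) (afterClass (σ zero) P) v ⟩
    ((P v xor first (σ zero) v) xor rest (σ zero) v) xor rest-sum
      ≡⟨ cong (_xor rest-sum) (trans (xor-assoc (P v) _ _) (cong (P v xor_) (first-xor-rest (σ zero) v))) ⟩
    (P v xor classMembers (σ zero) v) xor rest-sum
      ≡⟨ xor-assoc (P v) _ _ ⟩
    P v xor ∑[ i < suc m ] classMembers (σ i) v ∎
    where
    open ≡-Reasoning
    rest-sum = ∑[ i < m ] classMembers (σ (suc i)) v

  processedAfter-all : ∀ v → processedAfter id (λ _ → false) v ≡ I v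
  processedAfter-all v = trans (processedAfter-members id (λ _ → false) v) (∑-select (ι v) (λ _ → I v))

  Φ₀ : Code → Code → Bool
  Φ₀ l m = τ (classAt l) (classAt m)

  shape₀ : Shape (G ⊕ F) (λ _ → false) Φ₀
  shape₀ = record
    { loopless    = ⊕-diagonal G F
    ; processed   = λ _ ()
    ; classwise   = λ px py px′ py′ ιx ιy x≢y x′≢y′ →
                      trans (flip-on-I px py x≢y) (trans (cong₂ τ ιx ιy) (sym (flip-on-I px′ py′ x′≢y′)))
    ; closed-form = closed-form₀
    ; Φ-sym       = λ l m → Flip.τ-sym F (classAt l) (classAt m)
    }
    where
    flip-on-I : ∀ {x y} → Pending (λ _ → false) x → Pending (λ _ → false) y → x ≢ y →
                (G ⊕ F) x y ≡ τ (ι x) (ι y)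
    flip-on-I {x} {y} (Ix , _) (Iy , _) x≢y =
      trans (⊕-off-diagonal G F x≢y) (cong (_xor τ (ι x) (ι y)) (I-indep x y Ix Iy))
    closed-form₀ : ∀ {x y} → x ≢ y →
      (G ⊕ F) x y ≡ (G x y xor pathsThrough G (λ _ → false) x y) xor Φ₀ (code x) (code y)
    closed-form₀ {x} {y} x≢y = trans (⊕-off-diagonal G F x≢y)
      (cong₂ _xor_ (sym (trans (cong (G x y xor_) (∑-zero {n} _ λ _ → refl)) (xor-identityʳ (G x y))))
                   (sym (cong₂ τ (classAt-code x) (classAt-code y))))

  pending₀ : ∀ c → ClassPending (λ _ → false) c
  pending₀ c v v∈ = classMembers-I v∈ , refl

  final-shape : Shape (applyList parts (G ⊕ F)) (processedAfter id (λ _ → false)) (ΦAfter id Φ₀) ×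
                AllIndependentList parts (G ⊕ F)
  final-shape = shape-classes id (λ eq → eq) shape₀ pending₀

  F′ : Flip n (k * 16 ^ k)
  F′ = record { ι = code ; τ = ΦAfter id Φ₀ ; τ-sym = Shape.Φ-sym (proj₁ final-shape) }

  reproduces : ((G ∗ I) ⊕ F′) ≈ applyList parts (G ⊕ F)
  reproduces x y with x ≟ y
  ... | yes refl = sym (Shape.loopless (proj₁ final-shape) x)
  ... | no  x≢y  = begin
    (G ∗ I) x y xor Φ (code x) (code y)
      ≡⟨ cong (_xor Φ (code x) (code y)) (∗-closed-form I-indep x≢y) ⟩
    (G x y xor pathsThrough G I x y) xor Φ (code x) (code y)
      ≡⟨ cong (λ p → (G x y xor p) xor Φ (code x) (code y))
              (sum-cong-≗ λ v → cong (_∧ _) (sym (processedAfter-all v))) ⟩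
    (G x y xor pathsThrough G P x y) xor Φ (code x) (code y)
      ≡⟨ sym (closed-form x≢y) ⟩
    applyList parts (G ⊕ F) x y ∎
    where
    open ≡-Reasoning
    open Shape (proj₁ final-shape)
    Φ = ΦAfter id Φ₀
    P = processedAfter id (λ _ → false)

  length-partsOf : ∀ {m} (σ : Fin m → Fin k) → length (partsOf σ) ≡ 2 * m
  length-partsOf {zero}  σ = refl
  length-partsOf {suc m} σ = trans (cong (2 +_) (length-partsOf (σ ∘ suc))) (sym (*-suc 2 m))

  partsOf-⊆ : ∀ {m} (σ : Fin m → Fin k) → All (_⊆ I) (partsOf σ)
  partsOf-⊆ {zero}  σ = []
  partsOf-⊆ {suc m} σ = part-⊆-I (σ zero) zero ∷ part-⊆-I (σ zero) (suc zero) ∷ partsOf-⊆ (σ ∘ suc)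

  ∈-partsOf : ∀ {m} (σ : Fin m → Fin k) i {v} → first (σ i) v ≡ true ⊎ rest (σ i) v ≡ true →
              Any (λ J → J v ≡ true) (partsOf σ)
  ∈-partsOf σ zero    (inj₁ v∈) = here v∈
  ∈-partsOf σ zero    (inj₂ v∈) = there (here v∈)
  ∈-partsOf σ (suc i) v∈        = there (there (∈-partsOf (σ ∘ suc) i v∈))

  parts-cover : ∀ v → I v ≡ true → Any (λ J → J v ≡ true) parts
  parts-cover v Iv =
    ∈-partsOf id (ι v) (first-or-rest (trans (cong (_∧ I v) (dec-true (ι v ≟ ι v) refl)) Iv))

  partsOf-avoid : ∀ {m} (σ : Fin m → Fin k) {J c} → J ⊆ classMembers c → (∀ i → σ i ≢ c) →
                  All (Disjoint J) (partsOf σ)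
  partsOf-avoid {zero}  σ J⊆c σ≢c = []
  partsOf-avoid {suc m} σ J⊆c σ≢c =
    avoid zero ∷ avoid (suc zero) ∷ partsOf-avoid (σ ∘ suc) J⊆c (σ≢c ∘ suc)
    where
    avoid : ∀ s → Disjoint _ (part (σ zero) s)
    avoid s v v∈J v∈part = σ≢c zero (trans (sym (classMembers-ι (part-⊆ (σ zero) s v v∈part)))
                                           (classMembers-ι (J⊆c v v∈J)))

  partsOf-disjoint : ∀ {m} (σ : Fin m → Fin k) → Injective _≡_ _≡_ σ → AllPairs Disjoint (partsOf σ)
  partsOf-disjoint {zero}  σ σ-inj = []
  partsOf-disjoint {suc m} σ σ-inj =
    (first∩rest ∷ partsOf-avoid (σ ∘ suc) (part-⊆ (σ zero) zero) other-class) ∷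
    partsOf-avoid (σ ∘ suc) (part-⊆ (σ zero) (suc zero)) other-class ∷
    partsOf-disjoint (σ ∘ suc) (suc-injective ∘ σ-inj)
    where
    first∩rest : Disjoint (first (σ zero)) (rest (σ zero))
    first∩rest v v∈first v∈rest = contradiction (trans (sym (first-rest-disjoint v∈first)) v∈rest) λ ()
    other-class : ∀ i → σ (suc i) ≢ σ zero
    other-class i σi≡σ0 = contradiction (σ-inj σi≡σ0) λ ()

lemma5 : Σ (ℕ → ℕ) (λ f → ∀ (n : ℕ) (G : Adj n) → IsGraph G → (I : VSet n) → Independent G I →
           (k : ℕ) (F : Flip n k) →
           ∃[ p ] Σ (Fin p → VSet n) (λ J →
             p ≤ 2 * k × IsPartition I J × AllIndependent p J (G ⊕ F) ×
             Σ (Flip n (f k)) (λ F' → ((G ∗ I) ⊕ F') ≈ applyParts p J (G ⊕ F))))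
lemma5 = (λ k → k * 16 ^ k) , λ n G G-graph I I-indep k F →
  let open Construction G G-graph I I-indep F
  in length (dropEmpty parts) , lookup (dropEmpty parts) ,
     ≤-trans (length-filter nonEmpty? parts) (≤-reflexive (length-partsOf id)) ,
     dropEmpty-partition parts (partsOf-⊆ id) parts-cover (partsOf-disjoint id (λ eq → eq)) ,
     allIndependent-dropEmpty parts (λ _ _ → refl) (proj₂ final-shape) ,
     F′ , λ x y → trans (reproduces x y) (applyList-dropEmpty parts (λ _ _ → refl) x y)
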